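{- Define $q_1=\frac12$ and, for $t\ge 2$, $q_t=\frac{t-1}{2^t-t-1}\,q_{t-1}$. Then for all integers $t\ge 1$ and $n\ge 1$, $c_t(n)\le q_t 2^n$.
   Context: For positive integers $t$ and $m$, define \[ c_t(m)=\sum_{\substack{p_1>\cdots>p_t\ge 1\\ p_1+\cdots+p_t=m}}\frac{1}{t(t+1)}\prod_{i=1}^t\bigg(\frac{i+1}{i}\bigg)^{p_i}, \] the sum being over strictly decreasing sequences of $t$ positive integers summing to $m$ (an empty sum is $0$). -}

module Defs where

open import Data.Nat as ℕ using (ℕ; zero; suc; _∸_; _≤ᵇ_; _≡ᵇ_)
open import Data.Bool using (if_then_else_)
open import Data.List using (List; []; _∷_; concatMap; map; upTo; foldr; length)
open import Data.Integer using (+_)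
open import Data.Rational using (ℚ; 0ℚ; 1ℚ; _+_; _*_; _/_; _-_)

_^ℚ_ : ℚ → ℕ → ℚ
x ^ℚ zero = 1ℚ
x ^ℚ suc n = x * (x ^ℚ n)

-- strictDecSeqs t b m : all lists [p₁, …, p_t] with b ≥ p₁ > p₂ > ⋯ > p_t ≥ 1
-- and p₁ + ⋯ + p_t = m (each such list exactly once).
strictDecSeqs : ℕ → ℕ → ℕ → List (List ℕ)
strictDecSeqs zero b m = if m ≡ᵇ 0 then ([] ∷ []) else []
strictDecSeqs (suc t) b m =
  concatMap (λ k → let p = suc k in
               if p ≤ᵇ m then map (p ∷_) (strictDecSeqs t k (m ∸ p)) else [])
            (upTo b)

-- all strictly decreasing sequences of t positive integers summing to m
-- (the bound m on p₁ is automatic since all parts are positive)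
seqs : ℕ → ℕ → List (List ℕ)
seqs t m = strictDecSeqs t m m

-- ∏_{i=i₀}^{…} ((i+1)/i)^{p_i} for the list p starting at index i₀ = suc j
weight : ℕ → List ℕ → ℚ
weight j [] = 1ℚ
weight j (p ∷ ps) = ((+ (suc (suc j)) / (suc j)) ^ℚ p) * weight (suc j) ps

sumℚ : List ℚ → ℚ
sumℚ = foldr _+_ 0ℚ

-- c_t(m) = Σ_{p₁>⋯>p_t≥1, Σp=m} 1/(t(t+1)) ∏ ((i+1)/i)^{p_i}   (t ≥ 1)
c : ℕ → ℕ → ℚ
c zero m = 0ℚ   -- unused: the paper only defines c_t for t ≥ 1
c (suc t) m = sumℚ (map (λ p → (+ 1 / (suc t ℕ.* suc (suc t))) * weight 0 p) (seqs (suc t) m))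

q : ℕ → ℚ
q zero = 0ℚ     -- unused
q (suc zero) = + 1 / 2
-- the denominator 2^t - t - 1 (t = k+2) is written suc (2^t ∸ (t+2)), which
-- equals 2^t - t - 1 since 2^t ≥ t + 2 for t ≥ 2.
q (suc (suc k)) =
  (+ suc k / suc (2 ℕ.^ suc (suc k) ∸ suc (suc (suc (suc k))))) * q (suc k)

-- Write W_t(m) for the sum defining c_t(m) without the factor 1/(t(t+1)), and K_t = t(t+1) q_t,
-- so the claim is W_t(m) ≤ K_t 2^m. Removing the smallest part e from every part of a strictly
-- decreasing t-tuple leaves a strictly decreasing (t-1)-tuple of sum m - te, and the weight
-- factors as ∏_{i≤t} ((i+1)/i)^e = (t+1)^e; hence W_t(m) = Σ_e (t+1)^e W_{t-1}(m - te).
-- W_1(m) = 2^m and K_1 = 1 start the induction, and then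
--   W_t(m) ≤ K_{t-1} 2^m Σ_{e≥1} ((t+1)/2^t)^e ≤ K_{t-1} 2^m (t+1)/(2^t - t - 1) = K_t 2^m,
-- the last equality being the recursion for q_t.

module Submission where

open import Defs
open import Data.Nat as ℕ using (ℕ; zero; suc; _∸_; _≤ᵇ_)
import Data.Nat.Properties as ℕ
import Data.Nat.Tactic.RingSolver as ℕ-Solver
open import Data.Bool using (true; false; if_then_else_)
open import Data.List using (List; []; _∷_; _++_; concatMap; map; applyUpTo)
open import Data.List.Properties using (map-∘)
open import Data.Maybe using (nothing)
open import Data.Integer as ℤ using (+_)
import Data.Integer.Properties as ℤ
open import Data.Rational using (ℚ; 0ℚ; 1ℚ; _+_; _*_; _/_; _≤_; toℚᵘ; nonNegative)
open import Data.Rational.Properties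
import Data.Rational.Unnormalised as ℚᵘ
import Data.Rational.Unnormalised.Properties as ℚᵘ
open import Function using (_∘_; id)
open import Level using (0ℓ)
open import Relation.Binary.PropositionalEquality
open import Tactic.RingSolver using (solve-∀)
open import Tactic.RingSolver.Core.AlmostCommutativeRing using (AlmostCommutativeRing; fromCommutativeRing)

private variable A B : Set

ℚ-ring : AlmostCommutativeRing 0ℓ 0ℓ
ℚ-ring = fromCommutativeRing +-*-commutativeRing (λ _ → nothing)

fromℕ : ℕ → ℚ
fromℕ n = + n / 1

toℚᵘ-/ : ∀ n d → toℚᵘ (+ n / suc d) ℚᵘ.≃ ℚᵘ.mkℚᵘ (+ n) d
toℚᵘ-/ n d = toℚᵘ-fromℚᵘ (ℚᵘ.mkℚᵘ (+ n) d)

n/d*d≡n : ∀ n d .{{_ : ℕ.NonZero d}} → (+ n / d) * fromℕ d ≡ fromℕ n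
n/d*d≡n n (suc d) = toℚᵘ-injective (begin
  toℚᵘ ((+ n / suc d) * fromℕ (suc d))          ≈⟨ toℚᵘ-homo-* (+ n / suc d) (fromℕ (suc d)) ⟩
  toℚᵘ (+ n / suc d) ℚᵘ.* toℚᵘ (fromℕ (suc d))  ≈⟨ ℚᵘ.*-cong (toℚᵘ-/ n d) (toℚᵘ-/ (suc d) 0) ⟩
  ℚᵘ.mkℚᵘ (+ n) d ℚᵘ.* ℚᵘ.mkℚᵘ (+ suc d) 0      ≈⟨ ℚᵘ.*≡* eq ⟩
  ℚᵘ.mkℚᵘ (+ n) 0                               ≈⟨ toℚᵘ-/ n 0 ⟨
  toℚᵘ (fromℕ n)                                ∎)
  where
  open ℚᵘ.≃-Reasoning
  eq : (+ n ℤ.* + suc d) ℤ.* + 1 ≡ + n ℤ.* + suc (d ℕ.* 1)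
  eq rewrite ℕ.*-identityʳ d | ℤ.*-identityʳ (+ n ℤ.* + suc d) = refl

fromℕ-homo-* : ∀ a b → fromℕ (a ℕ.* b) ≡ fromℕ a * fromℕ b
fromℕ-homo-* a b = toℚᵘ-injective (begin
  toℚᵘ (fromℕ (a ℕ.* b))                 ≈⟨ toℚᵘ-/ (a ℕ.* b) 0 ⟩
  ℚᵘ.mkℚᵘ (+ (a ℕ.* b)) 0                ≈⟨ ℚᵘ.*≡* (cong (ℤ._* + 1) (ℤ.pos-* a b)) ⟩
  ℚᵘ.mkℚᵘ (+ a) 0 ℚᵘ.* ℚᵘ.mkℚᵘ (+ b) 0   ≈⟨ ℚᵘ.*-cong (toℚᵘ-/ a 0) (toℚᵘ-/ b 0) ⟨
  toℚᵘ (fromℕ a) ℚᵘ.* toℚᵘ (fromℕ b)     ≈⟨ toℚᵘ-homo-* (fromℕ a) (fromℕ b) ⟨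
  toℚᵘ (fromℕ a * fromℕ b)               ∎)
  where open ℚᵘ.≃-Reasoning

fromℕ-homo-+ : ∀ a b → fromℕ (a ℕ.+ b) ≡ fromℕ a + fromℕ b
fromℕ-homo-+ a b = toℚᵘ-injective (begin
  toℚᵘ (fromℕ (a ℕ.+ b))                 ≈⟨ toℚᵘ-/ (a ℕ.+ b) 0 ⟩
  ℚᵘ.mkℚᵘ (+ (a ℕ.+ b)) 0                ≈⟨ ℚᵘ.*≡* eq ⟩
  ℚᵘ.mkℚᵘ (+ a) 0 ℚᵘ.+ ℚᵘ.mkℚᵘ (+ b) 0   ≈⟨ ℚᵘ.+-cong (toℚᵘ-/ a 0) (toℚᵘ-/ b 0) ⟨
  toℚᵘ (fromℕ a) ℚᵘ.+ toℚᵘ (fromℕ b)     ≈⟨ toℚᵘ-homo-+ (fromℕ a) (fromℕ b) ⟨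
  toℚᵘ (fromℕ a + fromℕ b)               ∎)
  where
  open ℚᵘ.≃-Reasoning
  eq : + (a ℕ.+ b) ℤ.* + 1 ≡ (+ a ℤ.* + 1 ℤ.+ + b ℤ.* + 1) ℤ.* + 1
  eq rewrite ℤ.*-identityʳ (+ a) | ℤ.*-identityʳ (+ b) = cong (ℤ._* + 1) (ℤ.pos-+ a b)

^ℚ-distribˡ-+-* : ∀ x a b → x ^ℚ (a ℕ.+ b) ≡ x ^ℚ a * x ^ℚ b
^ℚ-distribˡ-+-* x zero    b = sym (*-identityˡ _)
^ℚ-distribˡ-+-* x (suc a) b = trans (cong (x *_) (^ℚ-distribˡ-+-* x a b)) (sym (*-assoc x _ _))

^ℚ-distribʳ-* : ∀ x y n → (x * y) ^ℚ n ≡ x ^ℚ n * y ^ℚ n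
^ℚ-distribʳ-* x y zero    = refl
^ℚ-distribʳ-* x y (suc n) = trans (cong ((x * y) *_) (^ℚ-distribʳ-* x y n)) (interchange x y (x ^ℚ n) (y ^ℚ n))
  where
  interchange : ∀ a b c d → (a * b) * (c * d) ≡ (a * c) * (b * d)
  interchange = solve-∀ ℚ-ring

^ℚ-*-assoc : ∀ x a b → (x ^ℚ a) ^ℚ b ≡ x ^ℚ (a ℕ.* b)
^ℚ-*-assoc x a zero    = cong (x ^ℚ_) (sym (ℕ.*-zeroʳ a))
^ℚ-*-assoc x a (suc b) = begin
  x ^ℚ a * (x ^ℚ a) ^ℚ b   ≡⟨ cong (x ^ℚ a *_) (^ℚ-*-assoc x a b) ⟩
  x ^ℚ a * x ^ℚ (a ℕ.* b)  ≡⟨ ^ℚ-distribˡ-+-* x a (a ℕ.* b) ⟨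
  x ^ℚ (a ℕ.+ a ℕ.* b)     ≡⟨ cong (x ^ℚ_) (sym (ℕ.*-suc a b)) ⟩
  x ^ℚ (a ℕ.* suc b)       ∎
  where open ≡-Reasoning

fromℕ-homo-^ : ∀ a n → fromℕ (a ℕ.^ n) ≡ fromℕ a ^ℚ n
fromℕ-homo-^ a zero    = refl
fromℕ-homo-^ a (suc n) = trans (fromℕ-homo-* a (a ℕ.^ n)) (cong (fromℕ a *_) (fromℕ-homo-^ a n))

/-nonNeg : ∀ n d .{{_ : ℕ.NonZero d}} → 0ℚ ≤ + n / d
/-nonNeg n d = nonNegative⁻¹ (+ n / d) {{normalize-nonNeg n d}}

*-nonNeg : ∀ {x y} → 0ℚ ≤ x → 0ℚ ≤ y → 0ℚ ≤ x * y
*-nonNeg {x} 0≤x 0≤y = subst (_≤ x * _) (*-zeroʳ x) (*-monoˡ-≤-nonNeg x {{nonNegative 0≤x}} 0≤y)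

^ℚ-nonNeg : ∀ {x} n → 0ℚ ≤ x → 0ℚ ≤ x ^ℚ n
^ℚ-nonNeg zero    _   = /-nonNeg 1 1
^ℚ-nonNeg (suc n) 0≤x = *-nonNeg 0≤x (^ℚ-nonNeg n 0≤x)

*-monoʳ-≤ : ∀ {c x y} → 0ℚ ≤ c → x ≤ y → c * x ≤ c * y
*-monoʳ-≤ {c} 0≤c = *-monoˡ-≤-nonNeg c {{nonNegative 0≤c}}

-- Finite sums

∑ : ℕ → (ℕ → ℚ) → ℚ
∑ zero    f = 0ℚ
∑ (suc b) f = f 0 + ∑ b (f ∘ suc)

infixl 10 ∑
syntax ∑ b (λ k → e) = ∑[ k < b ] e

∑-cong : ∀ {f g} b → (∀ k → f k ≡ g k) → ∑ b f ≡ ∑ b g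
∑-cong zero    f≗g = refl
∑-cong (suc b) f≗g = cong₂ _+_ (f≗g 0) (∑-cong b (f≗g ∘ suc))

∑-zero : ∀ b → ∑[ k < b ] 0ℚ ≡ 0ℚ
∑-zero zero    = refl
∑-zero (suc b) = trans (+-identityˡ _) (∑-zero b)

∑-+ : ∀ f g b → ∑[ k < b ] (f k + g k) ≡ ∑ b f + ∑ b g
∑-+ f g zero    = refl
∑-+ f g (suc b) = trans (cong (_+_ (f 0 + g 0)) (∑-+ (f ∘ suc) (g ∘ suc) b))
                        (interchange (f 0) (g 0) (∑ b (f ∘ suc)) (∑ b (g ∘ suc)))
  where
  interchange : ∀ a b c d → (a + b) + (c + d) ≡ (a + c) + (b + d)
  interchange = solve-∀ ℚ-ring

∑-*ˡ : ∀ c f b → ∑[ k < b ] (c * f k) ≡ c * ∑ b f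
∑-*ˡ c f zero    = sym (*-zeroʳ c)
∑-*ˡ c f (suc b) = trans (cong (_+_ (c * f 0)) (∑-*ˡ c (f ∘ suc) b)) (sym (*-distribˡ-+ c _ _))

∑-mono : ∀ {f g} b → (∀ k → f k ≤ g k) → ∑ b f ≤ ∑ b g
∑-mono zero    f≤g = ≤-refl
∑-mono (suc b) f≤g = +-mono-≤ (f≤g 0) (∑-mono b (f≤g ∘ suc))

∑-triangle : ∀ (f : ℕ → ℕ → ℚ) b →
  ∑[ k < b ] ∑[ e < k ] f k e ≡ ∑[ e < b ] ∑[ k < b ∸ suc e ] f (suc (e ℕ.+ k)) e
∑-triangle f zero    = refl
∑-triangle f (suc b) = begin
  0ℚ + ∑[ k < b ] (f (suc k) 0 + ∑[ e < k ] f (suc k) (suc e))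
    ≡⟨ +-identityˡ _ ⟩
  ∑[ k < b ] (f (suc k) 0 + ∑[ e < k ] f (suc k) (suc e))
    ≡⟨ ∑-+ (λ k → f (suc k) 0) (λ k → ∑[ e < k ] f (suc k) (suc e)) b ⟩
  ∑[ k < b ] f (suc k) 0 + ∑[ k < b ] ∑[ e < k ] f (suc k) (suc e)
    ≡⟨ cong (_+_ (∑[ k < b ] f (suc k) 0)) (∑-triangle (λ k e → f (suc k) (suc e)) b) ⟩
  ∑[ k < b ] f (suc k) 0 + ∑[ e < b ] ∑[ k < b ∸ suc e ] f (suc (suc (e ℕ.+ k))) (suc e) ∎
  where open ≡-Reasoning

-- Σ_{e≥1} x^e ≤ x/(1-x) = a/d for x = a/(d+a), stated without division.
geometric-≤ : ∀ {x d a} → 0ℚ ≤ x → 0ℚ ≤ a → (d + a) * x ≡ a → ∀ b → d * ∑[ e < b ] x ^ℚ suc e ≤ a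
geometric-≤ {x} {d} {a} 0≤x 0≤a [d+a]x≡a = go
  where
  expand : ∀ x d g → d * (x * 1ℚ + x * g) ≡ x * d + x * (d * g)
  expand = solve-∀ ℚ-ring
  collect : ∀ x d a → x * d + x * a ≡ (d + a) * x
  collect = solve-∀ ℚ-ring
  go : ∀ b → d * ∑[ e < b ] x ^ℚ suc e ≤ a
  go zero    = ≤-trans (≤-reflexive (*-zeroʳ d)) 0≤a
  go (suc b) = begin
    d * (x ^ℚ 1 + ∑[ e < b ] (x * x ^ℚ suc e))  ≡⟨ cong (λ s → d * (x ^ℚ 1 + s)) (∑-*ˡ x (λ e → x ^ℚ suc e) b) ⟩
    d * (x * 1ℚ + x * G)                         ≡⟨ expand x d G ⟩
    x * d + x * (d * G)                          ≤⟨ +-monoʳ-≤ (x * d) (*-monoʳ-≤ 0≤x (go b)) ⟩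
    x * d + x * a                                ≡⟨ collect x d a ⟩
    (d + a) * x                                  ≡⟨ [d+a]x≡a ⟩
    a                                            ∎
    where
    open ≤-Reasoning
    G = ∑[ e < b ] x ^ℚ suc e

sumℚ-map-++ : ∀ (f : A → ℚ) xs ys → sumℚ (map f (xs ++ ys)) ≡ sumℚ (map f xs) + sumℚ (map f ys)
sumℚ-map-++ f []       ys = sym (+-identityˡ _)
sumℚ-map-++ f (x ∷ xs) ys = trans (cong (_+_ (f x)) (sumℚ-map-++ f xs ys)) (sym (+-assoc (f x) _ _))

sumℚ-map-concatMap : ∀ (g : A → List B) (f : B → ℚ) xs →
  sumℚ (map f (concatMap g xs)) ≡ sumℚ (map (λ x → sumℚ (map f (g x))) xs)
sumℚ-map-concatMap g f []       = refl
sumℚ-map-concatMap g f (x ∷ xs) =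
  trans (sumℚ-map-++ f (g x) (concatMap g xs)) (cong (_+_ (sumℚ (map f (g x)))) (sumℚ-map-concatMap g f xs))

sumℚ-map-*ˡ : ∀ c (f : A → ℚ) xs → sumℚ (map (λ x → c * f x) xs) ≡ c * sumℚ (map f xs)
sumℚ-map-*ˡ c f []       = sym (*-zeroʳ c)
sumℚ-map-*ˡ c f (x ∷ xs) = trans (cong (_+_ (c * f x)) (sumℚ-map-*ˡ c f xs)) (sym (*-distribˡ-+ c _ _))

sumℚ-map-applyUpTo : ∀ (f : ℕ → ℚ) h b → sumℚ (map f (applyUpTo h b)) ≡ ∑[ k < b ] f (h k)
sumℚ-map-applyUpTo f h zero    = refl
sumℚ-map-applyUpTo f h (suc b) = cong (_+_ (f (h 0))) (sumℚ-map-applyUpTo f (h ∘ suc) b)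

-- Shifts: the generating function of shift a g is x^a times that of g

shift : ℕ → (ℕ → ℚ) → ℕ → ℚ
shift zero    g m       = g m
shift (suc a) g zero    = 0ℚ
shift (suc a) g (suc m) = shift a g m

shift-≤ᵇ : ∀ a g m → shift a g m ≡ (if a ≤ᵇ m then g (m ∸ a) else 0ℚ)
shift-≤ᵇ zero          g m       = refl
shift-≤ᵇ (suc a)       g zero    = refl
shift-≤ᵇ (suc zero)    g (suc m) = refl
shift-≤ᵇ (suc (suc a)) g (suc m) = shift-≤ᵇ (suc a) g m

shift-cong : ∀ a {g h} m → (∀ m' → g m' ≡ h m') → shift a g m ≡ shift a h m
shift-cong zero    m       g≗h = g≗h m
shift-cong (suc a) zero    g≗h = refl
shift-cong (suc a) (suc m) g≗h = shift-cong a m g≗h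

shift-+ : ∀ a c g m → shift a (shift c g) m ≡ shift (a ℕ.+ c) g m
shift-+ zero    c g m       = refl
shift-+ (suc a) c g zero    = refl
shift-+ (suc a) c g (suc m) = shift-+ a c g m

shift-*ˡ : ∀ a c g m → shift a (λ m' → c * g m') m ≡ c * shift a g m
shift-*ˡ zero    c g m       = refl
shift-*ˡ (suc a) c g zero    = sym (*-zeroʳ c)
shift-*ˡ (suc a) c g (suc m) = shift-*ˡ a c g m

shift-∑ : ∀ a (g : ℕ → ℕ → ℚ) b m → shift a (λ m' → ∑[ k < b ] g k m') m ≡ ∑[ k < b ] shift a (g k) m
shift-∑ zero    g b m       = refl
shift-∑ (suc a) g b zero    = sym (∑-zero b)
shift-∑ (suc a) g b (suc m) = shift-∑ a g b m

shift-mono : ∀ a {g h} m → (∀ m' → g m' ≤ h m') → shift a g m ≤ shift a h m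
shift-mono zero    m       g≤h = g≤h m
shift-mono (suc a) zero    g≤h = ≤-refl
shift-mono (suc a) (suc m) g≤h = shift-mono a m g≤h

shift-*-∑-shift : ∀ a c (h : ℕ → ℕ) (g : ℕ → ℕ → ℚ) b m →
  shift a (λ m' → c * ∑[ k < b ] shift (h k) (g k) m') m
  ≡ ∑[ k < b ] shift (a ℕ.+ h k) (λ m' → c * g k m') m
shift-*-∑-shift a c h g b m = begin
  shift a (λ m' → c * ∑[ k < b ] shift (h k) (g k) m') m  ≡⟨ shift-*ˡ a c _ m ⟩
  c * shift a (λ m' → ∑[ k < b ] shift (h k) (g k) m') m  ≡⟨ cong (c *_) (shift-∑ a (λ k → shift (h k) (g k)) b m) ⟩
  c * ∑[ k < b ] shift a (shift (h k) (g k)) m           ≡⟨ cong (c *_) (∑-cong b (λ k → shift-+ a (h k) (g k) m)) ⟩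
  c * ∑[ k < b ] shift (a ℕ.+ h k) (g k) m               ≡⟨ sym (∑-*ˡ c (λ k → shift (a ℕ.+ h k) (g k) m) b) ⟩
  ∑[ k < b ] (c * shift (a ℕ.+ h k) (g k) m)             ≡⟨ ∑-cong b (λ k → sym (shift-*ˡ (a ℕ.+ h k) c (g k) m)) ⟩
  ∑[ k < b ] shift (a ℕ.+ h k) (λ m' → c * g k m') m     ∎
  where open ≡-Reasoning

shift-geometric-≤ : ∀ {C x y} → 0ℚ ≤ C → 0ℚ ≤ x → 0ℚ ≤ y → x * y ≡ 1ℚ →
  ∀ a m → shift a (λ m' → C * x ^ℚ m') m ≤ C * x ^ℚ m * y ^ℚ a
shift-geometric-≤ {C} {x} {y} 0≤C 0≤x 0≤y xy≡1 = go
  where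
  rearrange : ∀ c a b u v → c * (a * u) * (b * v) ≡ c * u * v * (a * b)
  rearrange = solve-∀ ℚ-ring
  go : ∀ a m → shift a (λ m' → C * x ^ℚ m') m ≤ C * x ^ℚ m * y ^ℚ a
  go zero    m       = ≤-reflexive (sym (*-identityʳ _))
  go (suc a) zero    = *-nonNeg (*-nonNeg 0≤C (^ℚ-nonNeg 0 0≤x)) (^ℚ-nonNeg (suc a) 0≤y)
  go (suc a) (suc m) = ≤-trans (go a m) (≤-reflexive (sym (begin
    C * (x * x ^ℚ m) * (y * y ^ℚ a)   ≡⟨ rearrange C x y (x ^ℚ m) (y ^ℚ a) ⟩
    C * x ^ℚ m * y ^ℚ a * (x * y)     ≡⟨ cong (C * x ^ℚ m * y ^ℚ a *_) xy≡1 ⟩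
    C * x ^ℚ m * y ^ℚ a * 1ℚ          ≡⟨ *-identityʳ _ ⟩
    C * x ^ℚ m * y ^ℚ a               ∎)))
    where open ≡-Reasoning

-- Weighted sums over strictly decreasing sequences

r : ℕ → ℚ
r j = + suc (suc j) / suc j

r-nonNeg : ∀ j → 0ℚ ≤ r j
r-nonNeg j = /-nonNeg (suc (suc j)) (suc j)

δ : ℕ → ℚ
δ zero    = 1ℚ
δ (suc _) = 0ℚ

W : ℕ → ℕ → ℕ → ℕ → ℚ
W zero    j b m = δ m
W (suc t) j b m = ∑[ k < b ] shift (suc k) (λ m' → r j ^ℚ suc k * W t (suc j) k m') m

sumℚ-map-weight-∷ : ∀ j p L →
  sumℚ (map (weight j) (map (p ∷_) L)) ≡ r j ^ℚ p * sumℚ (map (weight (suc j)) L)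
sumℚ-map-weight-∷ j p L = trans (cong sumℚ (sym (map-∘ L))) (sumℚ-map-*ˡ (r j ^ℚ p) (weight (suc j)) L)

sumℚ-weight≡W : ∀ t j b m → sumℚ (map (weight j) (strictDecSeqs t b m)) ≡ W t j b m
sumℚ-weight≡W zero    j b zero    = +-identityʳ 1ℚ
sumℚ-weight≡W zero    j b (suc m) = refl
sumℚ-weight≡W (suc t) j b m =
  trans (sumℚ-map-concatMap _ (weight j) (applyUpTo id b))
        (trans (sumℚ-map-applyUpTo _ id b) (∑-cong b part))
  where
  part : ∀ k → sumℚ (map (weight j)
                        (if suc k ≤ᵇ m then map (suc k ∷_) (strictDecSeqs t k (m ∸ suc k)) else []))
             ≡ shift (suc k) (λ m' → r j ^ℚ suc k * W t (suc j) k m') m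
  part k rewrite shift-≤ᵇ (suc k) (λ m' → r j ^ℚ suc k * W t (suc j) k m') m with suc k ≤ᵇ m
  ... | true  = trans (sumℚ-map-weight-∷ j (suc k) (strictDecSeqs t k (m ∸ suc k)))
                      (cong (r j ^ℚ suc k *_) (sumℚ-weight≡W t (suc j) k (m ∸ suc k)))
  ... | false = refl

W-at-zero : ∀ t j b → W (suc t) j b 0 ≡ 0ℚ
W-at-zero t j b = ∑-zero b

-- R t j = ∏_{i=j+1}^{j+t+1} (i+1)/i: the factor gained by the weight j when each of t+1 parts grows by 1.
R : ℕ → ℕ → ℚ
R zero    j = r j
R (suc t) j = r j * R t (suc j)

R-telescope : ∀ t j → R t j * fromℕ (suc j) ≡ fromℕ (2 ℕ.+ (t ℕ.+ j))
R-telescope zero    j = n/d*d≡n (2 ℕ.+ j) (suc j)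
R-telescope (suc t) j = begin
  r j * R t (suc j) * fromℕ (suc j)    ≡⟨ rearrange (r j) (R t (suc j)) (fromℕ (suc j)) ⟩
  R t (suc j) * (r j * fromℕ (suc j))  ≡⟨ cong (R t (suc j) *_) (n/d*d≡n (2 ℕ.+ j) (suc j)) ⟩
  R t (suc j) * fromℕ (2 ℕ.+ j)         ≡⟨ R-telescope t (suc j) ⟩
  fromℕ (2 ℕ.+ (t ℕ.+ suc j))           ≡⟨ cong (λ n → fromℕ (2 ℕ.+ n)) (ℕ.+-suc t j) ⟩
  fromℕ (2 ℕ.+ (suc t ℕ.+ j))           ∎
  where
  open ≡-Reasoning
  rearrange : ∀ a b c → a * b * c ≡ b * (a * c)
  rearrange = solve-∀ ℚ-ring

R-at-zero : ∀ t → R t 0 ≡ fromℕ (2 ℕ.+ t)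
R-at-zero t = trans (sym (*-identityʳ (R t 0)))
                    (trans (R-telescope t 0) (cong (λ n → fromℕ (2 ℕ.+ n)) (ℕ.+-identityʳ t)))

W-tail : ∀ t j b m → W (suc t) j b m ≡
  ∑[ e < b ] shift (suc t ℕ.* suc e) (λ m' → R t j ^ℚ suc e * W t j (b ∸ suc e) m') m
W-tail zero    j b m =
  ∑-cong b (λ e → cong (λ a → shift a (λ m' → r j ^ℚ suc e * δ m') m) (sym (ℕ.*-identityˡ (suc e))))
W-tail (suc t) j b m = begin
  ∑[ k < b ] shift (suc k) (λ m' → r j ^ℚ suc k * W (suc t) (suc j) k m') m
    ≡⟨ ∑-cong b (λ k → shift-cong (suc k) m (λ m' → cong (r j ^ℚ suc k *_) (W-tail t (suc j) k m'))) ⟩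
  ∑[ k < b ] shift (suc k) (λ m' → r j ^ℚ suc k * ∑[ e < k ] shift (suc t ℕ.* suc e) (g k e) m') m
    ≡⟨ ∑-cong b (λ k → shift-*-∑-shift (suc k) (r j ^ℚ suc k) (λ e → suc t ℕ.* suc e) (g k) k m) ⟩
  ∑[ k < b ] ∑[ e < k ] shift (suc k ℕ.+ suc t ℕ.* suc e) (λ m' → r j ^ℚ suc k * g k e m') m
    ≡⟨ ∑-triangle (λ k e → shift (suc k ℕ.+ suc t ℕ.* suc e) (λ m' → r j ^ℚ suc k * g k e m') m) b ⟩
  ∑[ e < b ] ∑[ k < b ∸ suc e ] shift (2 ℕ.+ (e ℕ.+ k) ℕ.+ suc t ℕ.* suc e)
                                      (λ m' → r j ^ℚ (2 ℕ.+ (e ℕ.+ k)) * g (suc (e ℕ.+ k)) e m') m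
    ≡⟨ ∑-cong b (λ e → ∑-cong (b ∸ suc e) (reindex e)) ⟩
  ∑[ e < b ] ∑[ k < b ∸ suc e ] shift (suc (suc t) ℕ.* suc e ℕ.+ suc k)
                                      (λ m' → R (suc t) j ^ℚ suc e * (r j ^ℚ suc k * W t (suc j) k m')) m
    ≡⟨ ∑-cong b (λ e → sym (shift-*-∑-shift (suc (suc t) ℕ.* suc e) (R (suc t) j ^ℚ suc e) suc
                                              (λ k m' → r j ^ℚ suc k * W t (suc j) k m') (b ∸ suc e) m)) ⟩
  ∑[ e < b ] shift (suc (suc t) ℕ.* suc e) (λ m' → R (suc t) j ^ℚ suc e * W (suc t) j (b ∸ suc e) m') m ∎
  where
  open ≡-Reasoning
  g : ℕ → ℕ → ℕ → ℚ
  g k e m' = R t (suc j) ^ℚ suc e * W t (suc j) (k ∸ suc e) m'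
  shift-amount : ∀ e k → 2 ℕ.+ (e ℕ.+ k) ℕ.+ suc t ℕ.* suc e ≡ suc (suc t) ℕ.* suc e ℕ.+ suc k
  shift-amount = ℕ-Solver.solve-∀
  rearrange : ∀ a b c w → a * b * (c * w) ≡ (a * c) * (b * w)
  rearrange = solve-∀ ℚ-ring
  reindex : ∀ e k →
    shift (2 ℕ.+ (e ℕ.+ k) ℕ.+ suc t ℕ.* suc e) (λ m' → r j ^ℚ (2 ℕ.+ (e ℕ.+ k)) * g (suc (e ℕ.+ k)) e m') m
    ≡ shift (suc (suc t) ℕ.* suc e ℕ.+ suc k) (λ m' → R (suc t) j ^ℚ suc e * (r j ^ℚ suc k * W t (suc j) k m')) m
  reindex e k = trans (cong (λ a → shift a (λ m' → r j ^ℚ (2 ℕ.+ (e ℕ.+ k)) * g (suc (e ℕ.+ k)) e m') m)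
                             (shift-amount e k))
                       (shift-cong (suc (suc t) ℕ.* suc e ℕ.+ suc k) m coefficient)
    where
    coefficient : ∀ m' → r j ^ℚ (2 ℕ.+ (e ℕ.+ k)) * g (suc (e ℕ.+ k)) e m'
                       ≡ R (suc t) j ^ℚ suc e * (r j ^ℚ suc k * W t (suc j) k m')
    coefficient m' = begin
      r j ^ℚ (2 ℕ.+ (e ℕ.+ k)) * (R t (suc j) ^ℚ suc e * W t (suc j) (e ℕ.+ k ∸ e) m')
        ≡⟨ cong₂ (λ n i → r j ^ℚ n * (R t (suc j) ^ℚ suc e * W t (suc j) i m'))
                 (sym (ℕ.+-suc (suc e) k)) (ℕ.m+n∸m≡n e k) ⟩
      r j ^ℚ (suc e ℕ.+ suc k) * (R t (suc j) ^ℚ suc e * W t (suc j) k m')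
        ≡⟨ cong (_* (R t (suc j) ^ℚ suc e * W t (suc j) k m')) (^ℚ-distribˡ-+-* (r j) (suc e) (suc k)) ⟩
      r j ^ℚ suc e * r j ^ℚ suc k * (R t (suc j) ^ℚ suc e * W t (suc j) k m')
        ≡⟨ rearrange (r j ^ℚ suc e) (r j ^ℚ suc k) (R t (suc j) ^ℚ suc e) (W t (suc j) k m') ⟩
      r j ^ℚ suc e * R t (suc j) ^ℚ suc e * (r j ^ℚ suc k * W t (suc j) k m')
        ≡⟨ cong (_* (r j ^ℚ suc k * W t (suc j) k m')) (^ℚ-distribʳ-* (r j) (R t (suc j)) (suc e)) ⟨
      (r j * R t (suc j)) ^ℚ suc e * (r j ^ℚ suc k * W t (suc j) k m') ∎

W-one-suc : ∀ j b m → W 1 j (suc b) (suc m) ≡ r j * (δ m + W 1 j b m)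
W-one-suc j b m = begin
  r j ^ℚ 1 * δ m + ∑[ k < b ] shift (suc k) (λ m' → r j ^ℚ (2 ℕ.+ k) * δ m') m
    ≡⟨ cong₂ _+_ (cong (_* δ m) (*-identityʳ (r j))) (∑-cong b pull-r) ⟩
  r j * δ m + ∑[ k < b ] (r j * shift (suc k) (λ m' → r j ^ℚ suc k * δ m') m)
    ≡⟨ cong (_+_ (r j * δ m)) (∑-*ˡ (r j) (λ k → shift (suc k) (λ m' → r j ^ℚ suc k * δ m') m) b) ⟩
  r j * δ m + r j * W 1 j b m
    ≡⟨ *-distribˡ-+ (r j) (δ m) (W 1 j b m) ⟨
  r j * (δ m + W 1 j b m) ∎
  where
  open ≡-Reasoning
  pull-r : ∀ k → shift (suc k) (λ m' → r j ^ℚ (2 ℕ.+ k) * δ m') m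
               ≡ r j * shift (suc k) (λ m' → r j ^ℚ suc k * δ m') m
  pull-r k = trans (shift-cong (suc k) m (λ m' → *-assoc (r j) (r j ^ℚ suc k) (δ m')))
                   (shift-*ˡ (suc k) (r j) (λ m' → r j ^ℚ suc k * δ m') m)

W-one-≤ : ∀ j b m → W 1 j b m ≤ r j ^ℚ m
W-one-≤ j zero    m       = ^ℚ-nonNeg m (r-nonNeg j)
W-one-≤ j (suc b) zero    = ≤-trans (≤-reflexive (W-at-zero 0 j (suc b))) (^ℚ-nonNeg 0 (r-nonNeg j))
W-one-≤ j (suc b) (suc m) = begin
  W 1 j (suc b) (suc m)    ≡⟨ W-one-suc j b m ⟩
  r j * (δ m + W 1 j b m)  ≤⟨ *-monoʳ-≤ (r-nonNeg j) (δ+W≤ m) ⟩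
  r j * r j ^ℚ m           ∎
  where
  open ≤-Reasoning
  δ+W≤ : ∀ m → δ m + W 1 j b m ≤ r j ^ℚ m
  δ+W≤ zero    = ≤-reflexive (cong (_+_ 1ℚ) (W-at-zero 0 j b))
  δ+W≤ (suc m) = ≤-trans (≤-reflexive (+-identityˡ _)) (W-one-≤ j b (suc m))

-- The bound, by induction on the number of parts

two half : ℚ
two  = fromℕ 2
half = + 1 / 2

1^ℚn≡1 : ∀ n → 1ℚ ^ℚ n ≡ 1ℚ
1^ℚn≡1 zero    = refl
1^ℚn≡1 (suc n) = trans (*-identityˡ _) (1^ℚn≡1 n)

ρ : ℕ → ℚ
ρ t = fromℕ (3 ℕ.+ t) * half ^ℚ (2 ℕ.+ t)

2^[2+t]*ρ≡3+t : ∀ t → two ^ℚ (2 ℕ.+ t) * ρ t ≡ fromℕ (3 ℕ.+ t)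
2^[2+t]*ρ≡3+t t = begin
  two ^ℚ n * (a * half ^ℚ n)     ≡⟨ rearrange (two ^ℚ n) a (half ^ℚ n) ⟩
  a * (two ^ℚ n * half ^ℚ n)     ≡⟨ cong (a *_) (^ℚ-distribʳ-* two half n) ⟨
  a * (two * half) ^ℚ n          ≡⟨ cong (a *_) (1^ℚn≡1 n) ⟩
  a * 1ℚ                         ≡⟨ *-identityʳ a ⟩
  a                              ∎
  where
  open ≡-Reasoning
  n = 2 ℕ.+ t
  a = fromℕ (3 ℕ.+ t)
  rearrange : ∀ x y z → x * (y * z) ≡ y * (x * z)
  rearrange = solve-∀ ℚ-ring

4+t≤2^[2+t] : ∀ t → 4 ℕ.+ t ℕ.≤ 2 ℕ.^ (2 ℕ.+ t)
4+t≤2^[2+t] zero    = ℕ.≤-refl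
4+t≤2^[2+t] (suc t) = begin
  5 ℕ.+ t                  ≤⟨ ℕ.m≤m+n (5 ℕ.+ t) (3 ℕ.+ t) ⟩
  5 ℕ.+ t ℕ.+ (3 ℕ.+ t)    ≡⟨ double t ⟩
  2 ℕ.* (4 ℕ.+ t)          ≤⟨ ℕ.*-monoʳ-≤ 2 (4+t≤2^[2+t] t) ⟩
  2 ℕ.^ (3 ℕ.+ t)          ∎
  where
  open ℕ.≤-Reasoning
  double : ∀ t → 5 ℕ.+ t ℕ.+ (3 ℕ.+ t) ≡ 2 ℕ.* (4 ℕ.+ t)
  double = ℕ-Solver.solve-∀

-- The denominator 2^(t+2) - t - 3 of the recursion for q (t+2).
denom : ℕ → ℕ
denom t = suc (2 ℕ.^ (2 ℕ.+ t) ∸ (4 ℕ.+ t))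

q-nonNeg : ∀ t → 0ℚ ≤ q t
q-nonNeg zero          = ≤-refl
q-nonNeg (suc zero)    = /-nonNeg 1 2
q-nonNeg (suc (suc t)) = *-nonNeg (/-nonNeg (suc t) (denom t)) (q-nonNeg (suc t))

denom+3+t≡2^[2+t] : ∀ t → denom t ℕ.+ (3 ℕ.+ t) ≡ 2 ℕ.^ (2 ℕ.+ t)
denom+3+t≡2^[2+t] t = trans (sym (ℕ.+-suc _ (3 ℕ.+ t))) (ℕ.m∸n+n≡m (4+t≤2^[2+t] t))

K : ℕ → ℚ
K t = fromℕ (suc t ℕ.* (2 ℕ.+ t)) * q (suc t)

K-nonNeg : ∀ t → 0ℚ ≤ K t
K-nonNeg t = *-nonNeg (/-nonNeg (suc t ℕ.* (2 ℕ.+ t)) 1) (q-nonNeg (suc t))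

K-recurrence : ∀ t → K (suc t) * fromℕ (denom t) ≡ K t * fromℕ (3 ℕ.+ t)
K-recurrence t = begin
  fromℕ ((2 ℕ.+ t) ℕ.* (3 ℕ.+ t)) * ((+ suc t / denom t) * q₁) * d
    ≡⟨ rearrange (fromℕ ((2 ℕ.+ t) ℕ.* (3 ℕ.+ t))) (+ suc t / denom t) q₁ d ⟩
  fromℕ ((2 ℕ.+ t) ℕ.* (3 ℕ.+ t)) * ((+ suc t / denom t) * d) * q₁
    ≡⟨ cong (λ x → fromℕ ((2 ℕ.+ t) ℕ.* (3 ℕ.+ t)) * x * q₁) (n/d*d≡n (suc t) (denom t)) ⟩
  fromℕ ((2 ℕ.+ t) ℕ.* (3 ℕ.+ t)) * fromℕ (suc t) * q₁
    ≡⟨ cong (λ x → x * fromℕ (suc t) * q₁) (fromℕ-homo-* (2 ℕ.+ t) (3 ℕ.+ t)) ⟩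
  fromℕ (2 ℕ.+ t) * fromℕ (3 ℕ.+ t) * fromℕ (suc t) * q₁
    ≡⟨ reorder (fromℕ (suc t)) (fromℕ (2 ℕ.+ t)) (fromℕ (3 ℕ.+ t)) q₁ ⟩
  fromℕ (suc t) * fromℕ (2 ℕ.+ t) * q₁ * fromℕ (3 ℕ.+ t)
    ≡⟨ cong (λ x → x * q₁ * fromℕ (3 ℕ.+ t)) (fromℕ-homo-* (suc t) (2 ℕ.+ t)) ⟨
  fromℕ (suc t ℕ.* (2 ℕ.+ t)) * q₁ * fromℕ (3 ℕ.+ t) ∎
  where
  open ≡-Reasoning
  q₁ = q (suc t)
  d = fromℕ (denom t)
  rearrange : ∀ x y z w → x * (y * z) * w ≡ x * (y * w) * z
  rearrange = solve-∀ ℚ-ring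
  reorder : ∀ a b c z → b * c * a * z ≡ a * b * z * c
  reorder = solve-∀ ℚ-ring

K-geometric-≤ : ∀ t b → K t * ∑[ e < b ] ρ t ^ℚ suc e ≤ K (suc t)
K-geometric-≤ t b = *-cancelˡ-≤-pos d {{normalize-pos (denom t) 1}} (begin
  d * (K t * G)         ≡⟨ swap d (K t) G ⟩
  K t * (d * G)         ≤⟨ *-monoʳ-≤ (K-nonNeg t) (geometric-≤ {d = d} {a = a} ρ-nonNeg (/-nonNeg (3 ℕ.+ t) 1) [d+a]ρ≡a b) ⟩
  K t * a               ≡⟨ K-recurrence t ⟨
  K (suc t) * d         ≡⟨ *-comm (K (suc t)) d ⟩
  d * K (suc t)         ∎)
  where
  open ≤-Reasoning
  d = fromℕ (denom t)
  a = fromℕ (3 ℕ.+ t)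
  G = ∑[ e < b ] ρ t ^ℚ suc e
  swap : ∀ x y z → x * (y * z) ≡ y * (x * z)
  swap = solve-∀ ℚ-ring
  ρ-nonNeg : 0ℚ ≤ ρ t
  ρ-nonNeg = *-nonNeg (/-nonNeg (3 ℕ.+ t) 1) (^ℚ-nonNeg (2 ℕ.+ t) (/-nonNeg 1 2))
  [d+a]ρ≡a : (d + a) * ρ t ≡ a
  [d+a]ρ≡a = begin-equality
    (d + a) * ρ t                       ≡⟨ cong (_* ρ t) (fromℕ-homo-+ (denom t) (3 ℕ.+ t)) ⟨
    fromℕ (denom t ℕ.+ (3 ℕ.+ t)) * ρ t  ≡⟨ cong (λ n → fromℕ n * ρ t) (denom+3+t≡2^[2+t] t) ⟩
    fromℕ (2 ℕ.^ (2 ℕ.+ t)) * ρ t        ≡⟨ cong (_* ρ t) (fromℕ-homo-^ 2 (2 ℕ.+ t)) ⟩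
    two ^ℚ (2 ℕ.+ t) * ρ t               ≡⟨ 2^[2+t]*ρ≡3+t t ⟩
    a                                    ∎

tail-term-≤ : ∀ t e m →
  shift ((2 ℕ.+ t) ℕ.* suc e) (λ m' → fromℕ (3 ℕ.+ t) ^ℚ suc e * (K t * two ^ℚ m')) m
  ≤ K t * two ^ℚ m * ρ t ^ℚ suc e
tail-term-≤ t e m = begin
  shift L (λ m' → p * (K t * two ^ℚ m')) m     ≡⟨ shift-cong L m (λ m' → sym (*-assoc p (K t) (two ^ℚ m'))) ⟩
  shift L (λ m' → p * K t * two ^ℚ m') m       ≤⟨ shift-geometric-≤ 0≤pK (/-nonNeg 2 1) (/-nonNeg 1 2) refl L m ⟩
  p * K t * two ^ℚ m * half ^ℚ L               ≡⟨ cong (p * K t * two ^ℚ m *_) (^ℚ-*-assoc half (2 ℕ.+ t) (suc e)) ⟨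
  p * K t * two ^ℚ m * (half ^ℚ (2 ℕ.+ t)) ^ℚ suc e
                                               ≡⟨ rearrange p (K t) (two ^ℚ m) ((half ^ℚ (2 ℕ.+ t)) ^ℚ suc e) ⟩
  K t * two ^ℚ m * (p * (half ^ℚ (2 ℕ.+ t)) ^ℚ suc e)
                                               ≡⟨ cong (K t * two ^ℚ m *_) (^ℚ-distribʳ-* a (half ^ℚ (2 ℕ.+ t)) (suc e)) ⟨
  K t * two ^ℚ m * ρ t ^ℚ suc e                ∎
  where
  open ≤-Reasoning
  L = (2 ℕ.+ t) ℕ.* suc e
  a = fromℕ (3 ℕ.+ t)
  p = a ^ℚ suc e
  0≤pK : 0ℚ ≤ p * K t
  0≤pK = *-nonNeg (^ℚ-nonNeg (suc e) (/-nonNeg (3 ℕ.+ t) 1)) (K-nonNeg t)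
  rearrange : ∀ p k x h → p * k * x * h ≡ k * x * (p * h)
  rearrange = solve-∀ ℚ-ring

W-bound : ∀ t b m → W (suc t) 0 b m ≤ K t * two ^ℚ m
-- K 0 computes to 1ℚ.
W-bound zero    b m = ≤-trans (W-one-≤ 0 b m) (≤-reflexive (sym (*-identityˡ (two ^ℚ m))))
W-bound (suc t) b m = begin
  W (2 ℕ.+ t) 0 b m
    ≡⟨ W-tail (suc t) 0 b m ⟩
  ∑[ e < b ] shift (L e) (λ m' → R (suc t) 0 ^ℚ suc e * W (suc t) 0 (b ∸ suc e) m') m
    ≤⟨ ∑-mono b (λ e → shift-mono (L e) m (previous-bound e)) ⟩
  ∑[ e < b ] shift (L e) (λ m' → fromℕ (3 ℕ.+ t) ^ℚ suc e * (K t * two ^ℚ m')) m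
    ≤⟨ ∑-mono b (λ e → tail-term-≤ t e m) ⟩
  ∑[ e < b ] (K t * two ^ℚ m * ρ t ^ℚ suc e)
    ≡⟨ ∑-*ˡ (K t * two ^ℚ m) (λ e → ρ t ^ℚ suc e) b ⟩
  K t * two ^ℚ m * ∑[ e < b ] ρ t ^ℚ suc e
    ≡⟨ rearrange (K t) (two ^ℚ m) (∑[ e < b ] ρ t ^ℚ suc e) ⟩
  two ^ℚ m * (K t * ∑[ e < b ] ρ t ^ℚ suc e)
    ≤⟨ *-monoʳ-≤ (^ℚ-nonNeg m (/-nonNeg 2 1)) (K-geometric-≤ t b) ⟩
  two ^ℚ m * K (suc t)
    ≡⟨ *-comm (two ^ℚ m) (K (suc t)) ⟩
  K (suc t) * two ^ℚ m ∎
  where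
  open ≤-Reasoning
  L : ℕ → ℕ
  L e = (2 ℕ.+ t) ℕ.* suc e
  rearrange : ∀ k x g → k * x * g ≡ x * (k * g)
  rearrange = solve-∀ ℚ-ring
  previous-bound : ∀ e m' → R (suc t) 0 ^ℚ suc e * W (suc t) 0 (b ∸ suc e) m'
                     ≤ fromℕ (3 ℕ.+ t) ^ℚ suc e * (K t * two ^ℚ m')
  previous-bound e m' rewrite R-at-zero (suc t) =
    *-monoʳ-≤ (^ℚ-nonNeg (suc e) (/-nonNeg (3 ℕ.+ t) 1)) (W-bound t (b ∸ suc e) m')

proposition3p3 : (t n : ℕ) → c (suc t) (suc n) ≤ q (suc t) * ((+ 2 / 1) ^ℚ (suc n))
proposition3p3 t n = begin
  c (suc t) m                                   ≡⟨ sumℚ-map-*ˡ α (weight 0) (seqs (suc t) m) ⟩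
  α * sumℚ (map (weight 0) (seqs (suc t) m))    ≡⟨ cong (α *_) (sumℚ-weight≡W (suc t) 0 m m) ⟩
  α * W (suc t) 0 m m                           ≤⟨ *-monoʳ-≤ (/-nonNeg 1 N) (W-bound t m m) ⟩
  α * (K t * two ^ℚ m)                          ≡⟨ *-assoc α (K t) (two ^ℚ m) ⟨
  α * K t * two ^ℚ m                            ≡⟨ cong (_* two ^ℚ m) α*K≡q ⟩
  q (suc t) * two ^ℚ m                          ∎
  where
  open ≤-Reasoning
  m = suc n
  N = suc t ℕ.* (2 ℕ.+ t)
  α = + 1 / N
  α*K≡q : α * K t ≡ q (suc t)
  α*K≡q = begin-equality
    α * (fromℕ N * q (suc t))   ≡⟨ *-assoc α (fromℕ N) (q (suc t)) ⟨
    α * fromℕ N * q (suc t)     ≡⟨ cong (_* q (suc t)) (n/d*d≡n 1 N) ⟩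
    1ℚ * q (suc t)              ≡⟨ *-identityˡ (q (suc t)) ⟩
    q (suc t)                   ∎
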